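{- The $h$-vector of a matroid simplicial complex of dimension $1$ is a pure $O$-sequence.
   Context: An (abstract) simplicial complex $\Delta$ on $[n]=\{1,\dots,n\}$ is a family of subsets of $[n]$ closed under taking subsets; its elements are faces, maximal faces are facets, and $\Delta$ is pure if all facets have the same cardinality. Its dimension is $d$ where $d+1$ is the maximal cardinality of a face. $\Delta$ is a matroid if for every $W\subseteq[n]$ the restriction $\{F\in\Delta: F\subseteq W\}$ is pure. The $f$-vector is $(f_{ -1}=1,f_0,\dots,f_d)$ with $f_i$ the number of faces of cardinality $i+1$, and the $h$-vector $(h_0,\dots,h_{d+1})$ is defined by $\sum_{i=0}^{d+1}h_it^i=\sum_{i=0}^{d+1}f_{i-1}t^i(1-t)^{d+1-i}$ (trailing zeros are dropped). A pure $O$-sequence is the vector counting the monomials of each degree in a finite nonempty set of monomials closed under divisors whose maximal elements all have the same degree. -}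

module Defs where

open import Data.Nat using (ℕ; zero; suc; _+_; _≤_)
open import Data.Integer as ℤ using (ℤ; +_)
open import Data.Bool using (Bool; true; false; if_then_else_)
open import Data.List using (List; []; _∷_; map; length; filter; filterᵇ; _++_; foldr; reverse)
open import Data.List.Membership.Propositional using (_∈_)
open import Data.List.Relation.Unary.Unique.Propositional using (Unique)
open import Data.Vec using (Vec; []; _∷_)
open import Data.Vec.Relation.Binary.Pointwise.Inductive using (Pointwise)
open import Data.Fin.Subset using (Subset; _⊆_; ∣_∣; inside; outside)
open import Data.Product using (Σ; ∃; _×_; _,_)
open import Data.Unit using (⊤)
open import Relation.Binary.PropositionalEquality using (_≡_)
open import Relation.Nullary.Decidable using (⌊_⌋)
import Data.Nat as ℕ

allSubsets : (n : ℕ) → List (Subset n)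
allSubsets zero    = [] ∷ []
allSubsets (suc n) = map (inside ∷_) (allSubsets n) ++ map (outside ∷_) (allSubsets n)

Family : ℕ → Set
Family n = Subset n → Bool

IsFace : ∀ {n} → Family n → Subset n → Set
IsFace Δ F = Δ F ≡ true

IsSimplicialComplex : ∀ {n} → Family n → Set
IsSimplicialComplex Δ = ∀ F G → G ⊆ F → IsFace Δ F → IsFace Δ G

HasDimension : ∀ {n} → Family n → ℕ → Set
HasDimension Δ d =
  (Σ _ λ F → IsFace Δ F × ∣ F ∣ ≡ suc d) × (∀ F → IsFace Δ F → ∣ F ∣ ≤ suc d)

-- The restriction of Δ to W is pure: all its facets (maximal faces)
-- have the same cardinality.
RestrictionPure : ∀ {n} → Family n → Subset n → Set
RestrictionPure Δ W =
  ∃ λ k → ∀ F → IsFace Δ F → F ⊆ W →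
    (∀ G → IsFace Δ G → G ⊆ W → F ⊆ G → G ≡ F) → ∣ F ∣ ≡ k

IsMatroid : ∀ {n} → Family n → Set
IsMatroid Δ = ∀ W → RestrictionPure Δ W

-- number of faces of cardinality i  (= f_{i-1})
faceCount : ∀ {n} → Family n → ℕ → ℕ
faceCount {n} Δ i = length (filterᵇ (λ F → Δ F Data.Bool.∧ ⌊ ∣ F ∣ ℕ.≟ i ⌋) (allSubsets n))
  where import Data.Bool

-- integer polynomials as coefficient lists (constant term first)
Poly : Set
Poly = List ℤ

_⊕_ : Poly → Poly → Poly
[]       ⊕ q        = q
p        ⊕ []       = p
(a ∷ p)  ⊕ (b ∷ q)  = (a ℤ.+ b) ∷ (p ⊕ q)

scale : ℤ → Poly → Poly
scale c = map (c ℤ.*_)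

_⊛_ : Poly → Poly → Poly
[]      ⊛ q = []
(a ∷ p) ⊛ q = scale a q ⊕ (+ 0 ∷ (p ⊛ q))

pow : Poly → ℕ → Poly
pow p zero    = + 1 ∷ []
pow p (suc k) = p ⊛ pow p k

tP : Poly
tP = + 0 ∷ + 1 ∷ []

oneMinusT : Poly
oneMinusT = + 1 ∷ ℤ.- (+ 1) ∷ []

-- ∑_{i=0}^{d+1} f_{i-1} t^i (1-t)^{d+1-i}
hPoly : ∀ {n} → Family n → ℕ → Poly
hPoly Δ d = go 0 (suc d)
  where
  go : ℕ → ℕ → Poly   -- go i r : terms i, i+1, …, i+r  with  i + r = d+1
  go i zero    = scale (+ faceCount Δ i) (pow tP i)
  go i (suc r) = (scale (+ faceCount Δ i) (pow tP i ⊛ pow oneMinusT (suc r))) ⊕ go (suc i) r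

isZero : ℤ → Bool
isZero (+ zero) = true
isZero _        = false

dropTrailingZeros : Poly → Poly
dropTrailingZeros p = reverse (dropLeading (reverse p))
  where
  dropLeading : Poly → Poly
  dropLeading []      = []
  dropLeading (a ∷ q) = if isZero a then dropLeading q else a ∷ q

hVector : ∀ {n} → Family n → ℕ → List ℤ
hVector Δ d = dropTrailingZeros (hPoly Δ d)

-- monomials in m variables, as exponent vectors
Monomial : ℕ → Set
Monomial m = Vec ℕ m

_∣ₘ_ : ∀ {m} → Monomial m → Monomial m → Set
u ∣ₘ v = Pointwise _≤_ u v

deg : ∀ {m} → Monomial m → ℕ
deg = Data.Vec.foldr _ _+_ 0
  where import Data.Vec

-- finite set of monomials, given as a duplicate-free list
IsPureOrderIdeal : ∀ {m} → List (Monomial m) → ℕ → Set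
IsPureOrderIdeal {m} L D =
  Unique L
  × (Σ (Monomial m) λ u → u ∈ L)
  × (∀ u v → u ∈ L → v ∣ₘ u → v ∈ L)
  × (∀ u → u ∈ L → (∀ v → v ∈ L → u ∣ₘ v → v ≡ u) → deg u ≡ D)

countByDegree : ∀ {m} → List (Monomial m) → ℕ → List ℕ
countByDegree L D = map (λ i → length (filter (λ u → deg u ℕ.≟ i) L)) (Data.List.upTo (suc D))
  where import Data.List

IsPureOSequence : List ℤ → Set
IsPureOSequence h =
  Σ ℕ λ m → Σ (List (Monomial m)) λ L → Σ ℕ λ D →
    IsPureOrderIdeal L D × h ≡ map +_ (countByDegree L D)

module Submission where

-- A one-dimensional complex Δ is a graph together with the empty face.  The
-- matroid axiom, applied to W = {a, b, c}, gives the triangle property: a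
-- vertex c off an edge ab is adjacent to a or to b.  Adding the points of [n]
-- one at a time shows that such a graph is edgeless, a star, or has no
-- centre and satisfies 3v ≤ 2e + 4 (v vertices, e edges); always 2e + v ≤ v².
-- For a graph with an edge write v = a + 2 and e = a + b + 1; the h-vector
-- (f₋₁, f₀ - 2f₋₁, f₁ - f₀ + f₋₁) is then (1, a, b), with b = 0 for a star
-- and a ≤ 2b ≤ a(a + 1) otherwise.  Every such vector is a pure O-sequence:
-- (1, a, b) is realised by an order ideal of monomials in a variables whose
-- b quadrics cover all variables, built by adjoining variables one or two
-- at a time.

open import Defs
open import Data.Nat using (ℕ; zero; suc; _+_; _*_; _∸_; _≤_; _<_; z≤n; s≤s)
import Data.Nat as ℕ
open import Data.Nat.Properties
import Data.Nat.Solver as ℕSolver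
import Data.Integer as ℤ
import Data.Integer.Solver as ℤSolver
open import Data.Bool using (Bool; true; false; _∧_; T?)
import Data.Bool as Bool
open import Data.Bool.Properties using (∧-zeroʳ; ⇔→≡)
open import Function.Bundles using (mk⇔)
open import Data.Fin using (Fin; zero; suc)
import Data.Fin.Properties as FinP
open import Data.Fin.Subset using (Subset; ⁅_⁆; _∪_; inside; outside; _⊆_; ∣_∣) renaming (⊥ to ∅; _∈_ to _∈ₛ_)
open import Data.Fin.Subset.Properties
  using (∪-identityˡ; ∪-identityʳ; ∪-comm; p⊆p∪q; q⊆p∪q; out⊆; ⊆-refl; in⊆in; ⊥⊆; s⊆s; ∣⁅x⁆∣≡1; x∈p∪q⁻; x∈⁅y⁆⇒x≡y; x∈⁅x⁆; ⊆-antisym)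
open import Data.Vec using (Vec; []; _∷_; replicate)
import Data.Vec.Properties as VecP
open import Data.Vec.Relation.Binary.Pointwise.Inductive using ([]; _∷_)
open import Data.List using (List; []; _∷_; map; length; filter; filterᵇ; _++_)
open import Data.List.Properties using (filter-++; length-++; length-map; filter-accept; filter-reject)
open import Data.List.Membership.Propositional using (_∈_)
open import Data.List.Membership.Propositional.Properties using (∈-++⁺ˡ; ∈-++⁺ʳ; ∈-map⁺; ∈-map⁻; ∈-++⁻)
open import Data.List.Relation.Unary.Any using (here; there)
open import Data.List.Relation.Unary.All using (All; []; _∷_)
import Data.List.Relation.Unary.All as All
open import Data.List.Relation.Unary.AllPairs using ([]; _∷_)
open import Data.List.Relation.Unary.Unique.Propositional using (Unique)
import Data.List.Relation.Unary.Unique.Propositional.Properties as UniqueP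
open import Data.Product using (Σ; _×_; _,_; proj₁; proj₂)
open import Data.Sum using (_⊎_; inj₁; inj₂)
import Data.Sum as Sum
open import Data.Empty using (⊥-elim)
open import Relation.Nullary using (¬_; yes; no; ¬?)
open import Relation.Nullary.Decidable using (⌊_⌋; _×-dec_)
open import Relation.Binary.PropositionalEquality

boolToℕ : Bool → ℕ
boolToℕ true  = 1
boolToℕ false = 0

bit-mono : ∀ {x y} → (x ≡ true → y ≡ true) → boolToℕ x ≤ boolToℕ y
bit-mono {false} _   = z≤n
bit-mono {true}  x⇒y rewrite x⇒y refl = ≤-refl

count : ∀ {n} → (Fin n → Bool) → ℕ
count {zero}  f = 0
count {suc n} f = boolToℕ (f zero) + count (λ i → f (suc i))

count-cong : ∀ {n} (f g : Fin n → Bool) → (∀ i → f i ≡ g i) → count f ≡ count g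
count-cong {zero}  f g f≗g = refl
count-cong {suc n} f g f≗g =
  cong₂ _+_ (cong boolToℕ (f≗g zero)) (count-cong _ _ (λ i → f≗g (suc i)))

count-mono : ∀ {n} (f g : Fin n → Bool) → (∀ i → f i ≡ true → g i ≡ true) → count f ≤ count g
count-mono {zero}  _ _ _ = z≤n
count-mono {suc n} f g f⇒g = +-mono-≤ (bit-mono (f⇒g zero)) (count-mono _ _ (λ i → f⇒g (suc i)))

count-pos : ∀ {n} (f : Fin n → Bool) i → f i ≡ true → 1 ≤ count f
count-pos f zero    fi rewrite fi = s≤s z≤n
count-pos f (suc i) fi = ≤-trans (count-pos (λ i → f (suc i)) i fi) (m≤n+m _ (boolToℕ (f zero)))

count-witness : ∀ {n} (f : Fin n → Bool) → 1 ≤ count f → Σ (Fin n) λ i → f i ≡ true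
count-witness {zero}  f ()
count-witness {suc n} f pos with f zero in f0
... | true  = zero , f0
... | false with count-witness (λ i → f (suc i)) pos
...   | i , fi = suc i , fi

count-zero : ∀ {n} (f : Fin n → Bool) → (∀ i → ¬ f i ≡ true) → count f ≡ 0
count-zero {zero}  f none = refl
count-zero {suc n} f none with f zero in f0
... | true  = ⊥-elim (none zero f0)
... | false = count-zero (λ i → f (suc i)) (λ i → none (suc i))

count-two : ∀ {n} (f : Fin n → Bool) i j → f i ≡ true → f j ≡ true → i ≢ j → 2 ≤ count f
count-two f zero    zero    fi fj i≢j = ⊥-elim (i≢j refl)
count-two f zero    (suc j) fi fj i≢j rewrite fi = s≤s (count-pos (λ i → f (suc i)) j fj)
count-two f (suc i) zero    fi fj i≢j rewrite fj = s≤s (count-pos (λ i → f (suc i)) i fi)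
count-two f (suc i) (suc j) fi fj i≢j =
  ≤-trans (count-two (λ i → f (suc i)) i j fi fj (λ i≡j → i≢j (cong suc i≡j))) (m≤n+m _ (boolToℕ (f zero)))

count-one : ∀ {n} (f : Fin n → Bool) u → f u ≡ true → (∀ i → f i ≡ true → i ≡ u) → count f ≡ 1
count-one f zero fu only rewrite fu =
  cong suc (count-zero (λ i → f (suc i)) (λ i fi → FinP.0≢1+n (sym (only (suc i) fi))))
count-one f (suc u) fu only with f zero in f0
... | true  = ⊥-elim (FinP.0≢1+n (only zero f0))
... | false = count-one (λ i → f (suc i)) u fu (λ i fi → FinP.suc-injective (only (suc i) fi))

only-at : ∀ {n} (f : Fin n → Bool) u → ¬ (Σ (Fin n) λ i → f i ≡ true × i ≢ u) → ∀ i → f i ≡ true → i ≡ u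
only-at f u noOther i fi with i FinP.≟ u
... | yes i≡u = i≡u
... | no  i≢u = ⊥-elim (noOther (i , fi , i≢u))

count-except-one : ∀ {n} (f g : Fin n → Bool) u → f u ≡ true →
  (∀ i → i ≢ u → f i ≡ true → g i ≡ true) → count f ≤ suc (count g)
count-except-one f g zero fu f⇒g rewrite fu =
  s≤s (≤-trans (count-mono _ _ (λ i → f⇒g (suc i) (λ ()))) (m≤n+m _ (boolToℕ (g zero))))
count-except-one f g (suc u) fu f⇒g =
  ≤-trans (+-mono-≤ (bit-mono (f⇒g zero (λ ())))
                    (count-except-one (λ i → f (suc i)) (λ i → g (suc i)) u fu
                       (λ i i≢u → f⇒g (suc i) (λ e → i≢u (FinP.suc-injective e)))))
          (≤-reflexive (+-suc (boolToℕ (g zero)) _))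

suc-≢ : ∀ {n} {a b : Fin n} → a ≢ b → suc a ≢ suc b
suc-≢ a≢b e = a≢b (FinP.suc-injective e)

pred-≢ : ∀ {n} {a b : Fin n} → suc a ≢ suc b → a ≢ b
pred-≢ sa≢sb e = sa≢sb (cong suc e)

-- A complex of dimension at most one is a graph: its vertices are the
-- faces ⁅ i ⁆ and its edges the faces ⁅ a ⁆ ∪ ⁅ b ⁆ with a ≢ b.

edge : ∀ {n} → Fin n → Fin n → Subset n
edge a b = ⁅ a ⁆ ∪ ⁅ b ⁆

isVertex : ∀ {n} → Family n → Fin n → Bool
isVertex Δ i = Δ ⁅ i ⁆

deletion : ∀ {n} → Family (suc n) → Family n
deletion Δ S = Δ (outside ∷ S)

neighbour : ∀ {n} → Family (suc n) → Fin n → Bool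
neighbour Δ j = Δ (inside ∷ ⁅ j ⁆)

vertexCount : ∀ {n} → Family n → ℕ
vertexCount Δ = count (isVertex Δ)

edgeCount : ∀ {n} → Family n → ℕ
edgeCount {zero}  Δ = 0
edgeCount {suc n} Δ = count (neighbour Δ) + edgeCount (deletion Δ)

IsCentre : ∀ {n} → Family n → Fin n → Set
IsCentre Δ u = IsFace Δ ⁅ u ⁆ × (∀ a b → a ≢ b → IsFace Δ (edge a b) → a ≡ u ⊎ b ≡ u)

NoCentre : ∀ {n} → Family n → Set
NoCentre Δ = ∀ u → ¬ IsCentre Δ u

-- Every vertex c off an edge ab is adjacent to a or to b; i.e. non-adjacency
-- of distinct vertices is transitive (the graph is complete multipartite).
TriangleProperty : ∀ {n} → Family n → Set
TriangleProperty Δ = ∀ a b c → a ≢ b → c ≢ a → c ≢ b →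
  IsFace Δ (edge a b) → IsFace Δ ⁅ c ⁆ → IsFace Δ (edge a c) ⊎ IsFace Δ (edge b c)

edge-zero-suc : ∀ {n} (j : Fin n) → edge zero (suc j) ≡ inside ∷ ⁅ j ⁆
edge-zero-suc j = cong (inside ∷_) (∪-identityˡ ⁅ j ⁆)

edge-suc-zero : ∀ {n} (j : Fin n) → edge (suc j) zero ≡ inside ∷ ⁅ j ⁆
edge-suc-zero j = cong (inside ∷_) (∪-identityʳ ⁅ j ⁆)

edge-comm : ∀ {n} (a b : Fin n) → edge a b ≡ edge b a
edge-comm a b = ∪-comm ⁅ a ⁆ ⁅ b ⁆

module _ {n} {Δ : Family n} (sc : IsSimplicialComplex Δ) where

  face-⊆ : ∀ {S T} → T ⊆ S → IsFace Δ S → IsFace Δ T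
  face-⊆ {S} {T} = sc S T

  edge-vertexˡ : ∀ a b → IsFace Δ (edge a b) → IsFace Δ ⁅ a ⁆
  edge-vertexˡ a b = face-⊆ (p⊆p∪q ⁅ b ⁆)

  edge-vertexʳ : ∀ a b → IsFace Δ (edge a b) → IsFace Δ ⁅ b ⁆
  edge-vertexʳ a b = face-⊆ (q⊆p∪q ⁅ a ⁆ ⁅ b ⁆)

module _ {n} (Δ : Family (suc n)) where

  neighbour-of-edge : ∀ j → IsFace Δ (edge zero (suc j)) → neighbour Δ j ≡ true
  neighbour-of-edge j = subst (IsFace Δ) (edge-zero-suc j)

  neighbour-of-edge′ : ∀ j → IsFace Δ (edge (suc j) zero) → neighbour Δ j ≡ true
  neighbour-of-edge′ j = subst (IsFace Δ) (edge-suc-zero j)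

  edge-of-neighbour : ∀ j → neighbour Δ j ≡ true → IsFace Δ (edge zero (suc j))
  edge-of-neighbour j = subst (IsFace Δ) (sym (edge-zero-suc j))

  deletion-triangle : TriangleProperty Δ → TriangleProperty (deletion Δ)
  deletion-triangle tp a b c a≢b c≢a c≢b = tp (suc a) (suc b) (suc c) (suc-≢ a≢b) (suc-≢ c≢a) (suc-≢ c≢b)

  centre-deletion : ∀ u → IsCentre Δ (suc u) → IsCentre (deletion Δ) u
  centre-deletion u (vu , onEdges) = vu , λ a b a≢b ab →
    Sum.map FinP.suc-injective FinP.suc-injective (onEdges (suc a) (suc b) (suc-≢ a≢b) ab)

  centre-extend : ∀ u → IsCentre (deletion Δ) u → (∀ j → neighbour Δ j ≡ true → j ≡ u) → IsCentre Δ (suc u)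
  centre-extend u (vu , onEdges) onlyU = vu , onEdges′
    where
    onEdges′ : ∀ a b → a ≢ b → IsFace Δ (edge a b) → a ≡ suc u ⊎ b ≡ suc u
    onEdges′ zero    zero    a≢b ab = ⊥-elim (a≢b refl)
    onEdges′ zero    (suc b) a≢b ab = inj₂ (cong suc (onlyU b (neighbour-of-edge b ab)))
    onEdges′ (suc a) zero    a≢b ab = inj₁ (cong suc (onlyU a (neighbour-of-edge′ a ab)))
    onEdges′ (suc a) (suc b) a≢b ab = Sum.map (cong suc) (cong suc) (onEdges a b (pred-≢ a≢b) ab)

module _ {n} {Δ : Family (suc n)} (sc : IsSimplicialComplex Δ) where

  neighbour-vertex : ∀ j → neighbour Δ j ≡ true → isVertex (deletion Δ) j ≡ true
  neighbour-vertex j = face-⊆ sc (out⊆ ⊆-refl)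

  neighbour-vertex-zero : ∀ j → neighbour Δ j ≡ true → isVertex Δ zero ≡ true
  neighbour-vertex-zero j = face-⊆ sc (in⊆in ⊥⊆)

  no-neighbour-if-absent : isVertex Δ zero ≡ false → ∀ j → ¬ neighbour Δ j ≡ true
  no-neighbour-if-absent v₀ j lj with () ← trans (sym (neighbour-vertex-zero j lj)) v₀

  edgeCount-absent : isVertex Δ zero ≡ false → edgeCount Δ ≡ edgeCount (deletion Δ)
  edgeCount-absent v₀ = cong (_+ edgeCount (deletion Δ)) (count-zero (neighbour Δ) (no-neighbour-if-absent v₀))

  deletion-complex : IsSimplicialComplex (deletion Δ)
  deletion-complex S T T⊆S = sc (outside ∷ S) (outside ∷ T) (s⊆s T⊆S)

edgeCount-pos : ∀ {n} (Δ : Family n) a b → a ≢ b → IsFace Δ (edge a b) → 1 ≤ edgeCount Δ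
edgeCount-pos Δ zero    zero    a≢b ab = ⊥-elim (a≢b refl)
edgeCount-pos Δ zero    (suc b) a≢b ab = ≤-trans (count-pos (neighbour Δ) b (neighbour-of-edge Δ b ab)) (m≤m+n _ _)
edgeCount-pos Δ (suc a) zero    a≢b ab = ≤-trans (count-pos (neighbour Δ) a (neighbour-of-edge′ Δ a ab)) (m≤m+n _ _)
edgeCount-pos Δ (suc a) (suc b) a≢b ab = ≤-trans (edgeCount-pos (deletion Δ) a b (pred-≢ a≢b) ab) (m≤n+m _ (count (neighbour Δ)))

edgeCount-witness : ∀ {n} (Δ : Family n) → 1 ≤ edgeCount Δ →
  Σ (Fin n) λ a → Σ (Fin n) λ b → a ≢ b × IsFace Δ (edge a b)
edgeCount-witness {zero}  Δ ()
edgeCount-witness {suc n} Δ pos with 1 ℕ.≤? count (neighbour Δ)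
... | yes hasNeighbour with count-witness (neighbour Δ) hasNeighbour
...   | j , lj = zero , suc j , (λ ()) , edge-of-neighbour Δ j lj
edgeCount-witness {suc n} Δ pos | no noNeighbour
  with edgeCount-witness (deletion Δ) (subst (1 ≤_) (cong (_+ edgeCount (deletion Δ)) (n<1⇒n≡0 (≰⇒> noNeighbour))) pos)
... | a , b , a≢b , ab = suc a , suc b , suc-≢ a≢b , ab

-- The matroid axiom gives the triangle property: if c were joined to neither
-- end of the edge ab, then inside W = {a, b, c} both ab and ⁅ c ⁆ would be
-- maximal faces, of the different sizes 2 and 1.

edge-size : ∀ {n} (a b : Fin n) → a ≢ b → 2 ≤ ∣ edge a b ∣
edge-size zero    zero    a≢b = ⊥-elim (a≢b refl)
edge-size zero    (suc b) a≢b = subst (λ S → 2 ≤ ∣ S ∣) (sym (edge-zero-suc b)) (≤-reflexive (cong suc (sym (∣⁅x⁆∣≡1 b))))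
edge-size (suc a) zero    a≢b = subst (λ S → 2 ≤ ∣ S ∣) (sym (edge-suc-zero a)) (≤-reflexive (cong suc (sym (∣⁅x⁆∣≡1 a))))
edge-size (suc a) (suc b) a≢b = edge-size a b (pred-≢ a≢b)

edge-⊆ : ∀ {n} {S : Subset n} {x y} → x ∈ₛ S → y ∈ₛ S → edge x y ⊆ S
edge-⊆ {x = x} {y} x∈S y∈S z∈ with x∈p∪q⁻ ⁅ x ⁆ ⁅ y ⁆ z∈
... | inj₁ z∈x rewrite x∈⁅y⁆⇒x≡y x z∈x = x∈S
... | inj₂ z∈y rewrite x∈⁅y⁆⇒x≡y y z∈y = y∈S

matroid-triangle : ∀ {n} (Δ : Family n) → IsSimplicialComplex Δ → IsMatroid Δ → TriangleProperty Δ
matroid-triangle Δ sc mat a b c a≢b c≢a c≢b ab vc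
  with Δ (edge a c) Bool.≟ true | Δ (edge b c) Bool.≟ true
... | yes ac | _      = inj₁ ac
... | no _   | yes bc = inj₂ bc
... | no ¬ac | no ¬bc = ⊥-elim (<⇒≢ (edge-size a b a≢b) (trans (sym (∣⁅x⁆∣≡1 c)) (trans size-c (sym size-ab))))
  where
  W : Subset _
  W = edge a b ∪ ⁅ c ⁆

  k : ℕ
  k = proj₁ (mat W)

  ab-maximal : ∀ H → IsFace Δ H → H ⊆ W → edge a b ⊆ H → H ≡ edge a b
  ab-maximal H fH H⊆W ab⊆H = ⊆-antisym H⊆ab ab⊆H
    where
    a∈H : a ∈ₛ H
    a∈H = ab⊆H (p⊆p∪q ⁅ b ⁆ (x∈⁅x⁆ a))
    H⊆ab : H ⊆ edge a b
    H⊆ab {x} x∈H with x∈p∪q⁻ (edge a b) ⁅ c ⁆ (H⊆W x∈H)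
    ... | inj₁ x∈ab = x∈ab
    ... | inj₂ x∈c rewrite x∈⁅y⁆⇒x≡y c x∈c = ⊥-elim (¬ac (face-⊆ sc (edge-⊆ a∈H x∈H) fH))

  c-maximal : ∀ H → IsFace Δ H → H ⊆ W → ⁅ c ⁆ ⊆ H → H ≡ ⁅ c ⁆
  c-maximal H fH H⊆W c⊆H = ⊆-antisym H⊆c c⊆H
    where
    c∈H : c ∈ₛ H
    c∈H = c⊆H (x∈⁅x⁆ c)
    H⊆c : H ⊆ ⁅ c ⁆
    H⊆c {x} x∈H with x∈p∪q⁻ (edge a b) ⁅ c ⁆ (H⊆W x∈H)
    ... | inj₂ x∈c = x∈c
    ... | inj₁ x∈ab with x∈p∪q⁻ ⁅ a ⁆ ⁅ b ⁆ x∈ab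
    ...   | inj₁ x∈a rewrite x∈⁅y⁆⇒x≡y a x∈a = ⊥-elim (¬ac (face-⊆ sc (edge-⊆ x∈H c∈H) fH))
    ...   | inj₂ x∈b rewrite x∈⁅y⁆⇒x≡y b x∈b = ⊥-elim (¬bc (face-⊆ sc (edge-⊆ x∈H c∈H) fH))

  size-ab : ∣ edge a b ∣ ≡ k
  size-ab = proj₂ (mat W) (edge a b) ab (p⊆p∪q ⁅ c ⁆) ab-maximal

  size-c : ∣ ⁅ c ⁆ ∣ ≡ k
  size-c = proj₂ (mat W) ⁅ c ⁆ vc (q⊆p∪q (edge a b) ⁅ c ⁆) c-maximal

data Shape {n} (Δ : Family n) (v e : ℕ) : Set where
  edgeless : e ≡ 0 → Shape Δ v e
  star     : ∀ u → IsCentre Δ u → suc e ≡ v → 1 ≤ e → Shape Δ v e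
  spread   : NoCentre Δ → 1 ≤ e → 3 * v ≤ 2 * e + 4 → v ≤ suc e → Shape Δ v e

-- Arithmetic for the `spread` inequalities after adding a vertex of degree d
-- to a graph with v vertices and e edges.

-- a star with e edges (hence e + 1 vertices) plus a vertex of degree d ≥ 2 on its leaves
spread-star : ∀ d e → 2 ≤ d → suc e ≤ suc d → 3 * suc (suc e) ≤ 2 * (d + e) + 4
spread-star d e 2≤d (s≤s e≤d) = begin
    3 * suc (suc e)       ≡⟨ solve 1 (λ e → con 3 :* (con 1 :+ (con 1 :+ e)) := (e :+ con 2) :+ (e :+ e :+ con 4)) refl e ⟩
    (e + 2) + (e + e + 4) ≤⟨ +-monoˡ-≤ (e + e + 4) (+-mono-≤ e≤d 2≤d) ⟩
    (d + d) + (e + e + 4) ≡⟨ solve 2 (λ d e → (d :+ d) :+ (e :+ e :+ con 4) := con 2 :* (d :+ e) :+ con 4) refl d e ⟩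
    2 * (d + e) + 4       ∎
  where open ≤-Reasoning; open ℕSolver.+-*-Solver

-- a star with e edges plus a vertex joined to all of its e + 1 vertices
spread-cone : ∀ e → 3 * suc (suc e) ≤ 2 * (suc e + e) + 4
spread-cone e = begin
    3 * suc (suc e)     ≡⟨ solve 1 (λ e → con 3 :* (con 1 :+ (con 1 :+ e)) := con 3 :* e :+ con 6) refl e ⟩
    3 * e + 6           ≤⟨ +-monoˡ-≤ 6 (*-monoˡ-≤ e {3} {4} (s≤s (s≤s (s≤s z≤n)))) ⟩
    4 * e + 6           ≡⟨ solve 1 (λ e → con 4 :* e :+ con 6 := con 2 :* ((con 1 :+ e) :+ e) :+ con 4) refl e ⟩
    2 * (suc e + e) + 4 ∎
  where open ≤-Reasoning; open ℕSolver.+-*-Solver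

spread-grow : ∀ d e v → 3 * v ≤ 2 * e + 4 → 2 ≤ d → 3 * suc v ≤ 2 * (d + e) + 4
spread-grow d e v ineq 2≤d = begin
    3 * suc v             ≡⟨ solve 1 (λ v → con 3 :* (con 1 :+ v) := con 3 :* v :+ con 3) refl v ⟩
    3 * v + 3             ≤⟨ +-mono-≤ ineq (≤-trans (s≤s (s≤s (s≤s z≤n))) (*-monoʳ-≤ 2 2≤d)) ⟩
    (2 * e + 4) + 2 * d   ≡⟨ solve 2 (λ d e → (con 2 :* e :+ con 4) :+ con 2 :* d := con 2 :* (d :+ e) :+ con 4) refl d e ⟩
    2 * (d + e) + 4       ∎
  where open ≤-Reasoning; open ℕSolver.+-*-Solver

connected-grow : ∀ d e v → v ≤ suc e → 1 ≤ d → suc v ≤ suc (d + e)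
connected-grow d e v v≤e+1 1≤d = s≤s (≤-trans v≤e+1 (+-monoˡ-≤ e 1≤d))

shape-absent : ∀ {n} (Δ : Family (suc n)) → IsSimplicialComplex Δ → isVertex Δ zero ≡ false →
  Shape (deletion Δ) (vertexCount (deletion Δ)) (edgeCount (deletion Δ)) →
  Shape Δ (vertexCount (deletion Δ)) (edgeCount Δ)
shape-absent Δ sc v₀ sh = subst (Shape Δ _) (sym (edgeCount-absent sc v₀)) (lift sh)
  where
  noNeighbour : ∀ j → ¬ neighbour Δ j ≡ true
  noNeighbour = no-neighbour-if-absent sc v₀

  lift : ∀ {v e} → Shape (deletion Δ) v e → Shape Δ v e
  lift (edgeless e≡0)           = edgeless e≡0
  lift (star u c e+1≡v 1≤e)     = star (suc u) (centre-extend Δ u c (λ j lj → ⊥-elim (noNeighbour j lj))) e+1≡v 1≤e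
  lift (spread noC 1≤e ineq conn) = spread noCentre 1≤e ineq conn
    where
    noCentre : NoCentre Δ
    noCentre zero    (v₀′ , _) with () ← trans (sym v₀′) v₀
    noCentre (suc z) c = noC z (centre-deletion Δ z c)

module AddVertex {n} (Δ : Family (suc n)) (sc : IsSimplicialComplex Δ) (tp : TriangleProperty Δ)
                 (v₀ : isVertex Δ zero ≡ true) where

  Γ : Family n
  Γ = deletion Δ

  d : ℕ
  d = count (neighbour Δ)

  v : ℕ
  v = vertexCount Γ

  e : ℕ
  e = edgeCount Γ

  -- The triangle property at 0: every edge of Γ has an end joined to 0.
  edge-meets-neighbour : ∀ a b → a ≢ b → IsFace Γ (edge a b) → neighbour Δ a ≡ true ⊎ neighbour Δ b ≡ true
  edge-meets-neighbour a b a≢b ab = Sum.map (neighbour-of-edge′ Δ a) (neighbour-of-edge′ Δ b)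
    (tp (suc a) (suc b) zero (suc-≢ a≢b) (λ ()) (λ ()) ab v₀)

  -- The triangle property at j: a vertex k not adjacent to a neighbour j of 0 is itself joined to 0.
  neighbour-propagates : ∀ j k → neighbour Δ j ≡ true → isVertex Γ k ≡ true → k ≢ j →
    ¬ IsFace Γ (edge j k) → neighbour Δ k ≡ true
  neighbour-propagates j k lj vk k≢j ¬jk
    with tp zero (suc j) (suc k) (λ ()) (λ ()) (suc-≢ k≢j) (edge-of-neighbour Δ j lj) vk
  ... | inj₁ 0k = neighbour-of-edge Δ k 0k
  ... | inj₂ jk = ⊥-elim (¬jk jk)

  neighbour-everywhere : (∀ k → isVertex Γ k ≡ true → neighbour Δ k ≡ true) → d ≡ v
  neighbour-everywhere all =
    count-cong (neighbour Δ) (isVertex Γ) λ k → ⇔→≡ (mk⇔ (neighbour-vertex sc k) (all k))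

  zero-not-centre : ∀ a b → a ≢ b → IsFace Γ (edge a b) → ¬ IsCentre Δ zero
  zero-not-centre a b a≢b ab (_ , onEdges) with onEdges (suc a) (suc b) (suc-≢ a≢b) ab
  ... | inj₁ ()
  ... | inj₂ ()

  two-neighbours-no-centre : ∀ j k → neighbour Δ j ≡ true → neighbour Δ k ≡ true → j ≢ k → ∀ z → ¬ IsCentre Δ (suc z)
  two-neighbours-no-centre j k lj lk j≢k z (_ , onEdges)
    with onEdges zero (suc j) (λ ()) (edge-of-neighbour Δ j lj) | onEdges zero (suc k) (λ ()) (edge-of-neighbour Δ k lk)
  ... | inj₁ () | _
  ... | inj₂ _  | inj₁ ()
  ... | inj₂ j≡z | inj₂ k≡z = j≢k (FinP.suc-injective (trans j≡z (sym k≡z)))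

  fromEdgeless : e ≡ 0 → Shape Δ (suc v) (d + e)
  fromEdgeless e≡0 with 1 ℕ.≤? d
  ... | no  d≱1 = edgeless (cong₂ _+_ (n<1⇒n≡0 (≰⇒> d≱1)) e≡0)
  ... | yes d≥1 with count-witness (neighbour Δ) d≥1
  ...   | j , lj = star zero (v₀ , centre) counts (≤-trans d≥1 (m≤m+n d e))
    where
    noEdge : ∀ a b → a ≢ b → ¬ IsFace Γ (edge a b)
    noEdge a b a≢b ab with () ← subst (1 ≤_) e≡0 (edgeCount-pos Γ a b a≢b ab)

    centre : ∀ a b → a ≢ b → IsFace Δ (edge a b) → a ≡ zero ⊎ b ≡ zero
    centre zero    b       a≢b ab = inj₁ refl
    centre (suc a) zero    a≢b ab = inj₂ refl
    centre (suc a) (suc b) a≢b ab = ⊥-elim (noEdge a b (pred-≢ a≢b) ab)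

    allJoined : ∀ k → isVertex Γ k ≡ true → neighbour Δ k ≡ true
    allJoined k vk with k FinP.≟ j
    ... | yes refl = lj
    ... | no  k≢j  = neighbour-propagates j k lj vk k≢j (noEdge j k (λ j≡k → k≢j (sym j≡k)))

    counts : suc (d + e) ≡ suc v
    counts = cong suc (trans (cong₂ _+_ (neighbour-everywhere allJoined) e≡0) (+-identityʳ v))

  -- If Γ is a star centred at u, then Δ is a star (centred at u, or at a leaf l
  -- when Γ is the single edge ul and 0 is joined to l only) or has no centre.
  module FromStar (u : Fin n) (centreΓ : IsCentre Γ u) (e+1≡v : suc e ≡ v) (1≤e : 1 ≤ e) where

    onEdges : ∀ a b → a ≢ b → IsFace Γ (edge a b) → a ≡ u ⊎ b ≡ u
    onEdges = proj₂ centreΓ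

    leaf : Σ (Fin n) λ l → l ≢ u × IsFace Γ (edge u l)
    leaf with edgeCount-witness Γ 1≤e
    ... | a , b , a≢b , ab with onEdges a b a≢b ab
    ...   | inj₁ refl = b , (λ b≡a → a≢b (sym b≡a)) , ab
    ...   | inj₂ refl = a , a≢b , subst (IsFace Γ) (edge-comm a b) ab

    l₀ : Fin n
    l₀ = proj₁ leaf

    l₀≢u : l₀ ≢ u
    l₀≢u = proj₁ (proj₂ leaf)

    ul₀ : IsFace Γ (edge u l₀)
    ul₀ = proj₂ (proj₂ leaf)

    no-edge-off-centre : ∀ a b → a ≢ u → b ≢ u → a ≢ b → ¬ IsFace Γ (edge a b)
    no-edge-off-centre a b a≢u b≢u a≢b ab with onEdges a b a≢b ab
    ... | inj₁ a≡u = a≢u a≡u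
    ... | inj₂ b≡u = b≢u b≡u

    joined-to-centre : ∀ l → isVertex Γ l ≡ true → l ≢ u → IsFace Γ (edge u l)
    joined-to-centre l vl l≢u with l FinP.≟ l₀
    ... | yes refl = ul₀
    ... | no  l≢l₀ with deletion-triangle Δ tp u l₀ l (λ u≡l₀ → l₀≢u (sym u≡l₀)) l≢u l≢l₀ ul₀ vl
    ...   | inj₁ ul  = ul
    ...   | inj₂ l₀l = ⊥-elim (no-edge-off-centre l₀ l l₀≢u l≢u (λ l₀≡l → l≢l₀ (sym l₀≡l)) l₀l)

    -- 0 joined to no leaf: it is one more leaf of u.
    newLeaf : ¬ (Σ (Fin n) λ l → neighbour Δ l ≡ true × l ≢ u) → Shape Δ (suc v) (d + e)
    newLeaf noLeafJoined = star (suc u) (centre-extend Δ u centreΓ onlyU) counts (≤-trans 1≤e (m≤n+m e d))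
      where
      onlyU : ∀ j → neighbour Δ j ≡ true → j ≡ u
      onlyU = only-at (neighbour Δ) u noLeafJoined

      lu : neighbour Δ u ≡ true
      lu with edge-meets-neighbour u l₀ (λ u≡l₀ → l₀≢u (sym u≡l₀)) ul₀
      ... | inj₁ lu  = lu
      ... | inj₂ ll₀ = ⊥-elim (noLeafJoined (l₀ , ll₀ , l₀≢u))

      counts : suc (d + e) ≡ suc v
      counts = trans (cong (λ k → suc (k + e)) (count-one (neighbour Δ) u lu onlyU)) (cong suc e+1≡v)

    -- 0 joined to a leaf l: then it is joined to every leaf.
    module JoinedToLeaf (l : Fin n) (ll : neighbour Δ l ≡ true) (l≢u : l ≢ u) where

      all-leaves-joined : ∀ k → isVertex Γ k ≡ true → k ≢ u → neighbour Δ k ≡ true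
      all-leaves-joined k vk k≢u with k FinP.≟ l
      ... | yes refl = ll
      ... | no  k≢l  = neighbour-propagates l k ll vk k≢l (no-edge-off-centre l k l≢u k≢u (λ l≡k → k≢l (sym l≡k)))

      ul : IsFace Γ (edge u l)
      ul = joined-to-centre l (neighbour-vertex sc l ll) l≢u

      -- 0 joined to u as well: Δ is the cone over the star Γ, with d = v = e + 1.
      cone : neighbour Δ u ≡ true → Shape Δ (suc v) (d + e)
      cone lu = spread noCentre (≤-trans 1≤e (m≤n+m e d)) ineq conn
        where
        allJoined : ∀ k → isVertex Γ k ≡ true → neighbour Δ k ≡ true
        allJoined k vk with k FinP.≟ u
        ... | yes refl = lu
        ... | no  k≢u  = all-leaves-joined k vk k≢u

        d≡v : d ≡ v
        d≡v = neighbour-everywhere allJoined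

        ineq : 3 * suc v ≤ 2 * (d + e) + 4
        ineq = subst (λ x → 3 * suc v ≤ 2 * (x + e) + 4) (sym d≡v)
                 (subst (λ w → 3 * suc w ≤ 2 * (w + e) + 4) e+1≡v (spread-cone e))

        conn : suc v ≤ suc (d + e)
        conn = subst (λ x → suc v ≤ suc (x + e)) (sym d≡v) (s≤s (m≤m+n v e))

        noCentre : NoCentre Δ
        noCentre zero    = zero-not-centre u l (λ u≡l → l≢u (sym u≡l)) ul
        noCentre (suc z) = two-neighbours-no-centre l u ll lu l≢u z

      secondLeaf : ∀ l′ → isVertex Γ l′ ≡ true → l′ ≢ u → l′ ≢ l → Shape Δ (suc v) (d + e)
      secondLeaf l′ vl′ l′≢u l′≢l = spread noCentre (≤-trans (≤-trans (s≤s z≤n) 2≤d) (m≤m+n d e)) ineq conn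
        where
        ll′ : neighbour Δ l′ ≡ true
        ll′ = all-leaves-joined l′ vl′ l′≢u

        l≢l′ : l ≢ l′
        l≢l′ l≡l′ = l′≢l (sym l≡l′)

        2≤d : 2 ≤ d
        2≤d = count-two (neighbour Δ) l l′ ll ll′ l≢l′

        v≤d+1 : v ≤ suc d
        v≤d+1 = count-except-one (isVertex Γ) (neighbour Δ) u (proj₁ centreΓ) (λ k k≢u vk → all-leaves-joined k vk k≢u)

        ineq : 3 * suc v ≤ 2 * (d + e) + 4
        ineq = subst (λ w → 3 * suc w ≤ 2 * (d + e) + 4) e+1≡v
                 (spread-star d e 2≤d (subst (_≤ suc d) (sym e+1≡v) v≤d+1))

        conn : suc v ≤ suc (d + e)
        conn = connected-grow d e v (≤-reflexive (sym e+1≡v)) (≤-trans (s≤s z≤n) 2≤d)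

        noCentre : NoCentre Δ
        noCentre zero    = zero-not-centre u l (λ u≡l → l≢u (sym u≡l)) ul
        noCentre (suc z) = two-neighbours-no-centre l l′ ll ll′ l≢l′ z

      -- Γ is the single edge ul and 0 is joined to l only: Δ is a path centred at l.
      path : ¬ neighbour Δ u ≡ true → (∀ k → isVertex Γ k ≡ true → k ≢ u → k ≡ l) → Shape Δ (suc v) (d + e)
      path ¬lu onlyLeaf = star (suc l) (centre-extend Δ l centre-l onlyL) counts (≤-trans 1≤e (m≤n+m e d))
        where
        onlyL : ∀ j → neighbour Δ j ≡ true → j ≡ l
        onlyL j lj with j FinP.≟ u
        ... | yes refl = ⊥-elim (¬lu lj)
        ... | no  j≢u  = onlyLeaf j (neighbour-vertex sc j lj) j≢u

        centre-l : IsCentre Γ l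
        centre-l = neighbour-vertex sc l ll , onEdges-l
          where
          onEdges-l : ∀ a b → a ≢ b → IsFace Γ (edge a b) → a ≡ l ⊎ b ≡ l
          onEdges-l a b a≢b ab with onEdges a b a≢b ab
          ... | inj₁ refl = inj₂ (onlyLeaf b (edge-vertexʳ (deletion-complex sc) a b ab) (λ b≡a → a≢b (sym b≡a)))
          ... | inj₂ refl = inj₁ (onlyLeaf a (edge-vertexˡ (deletion-complex sc) a b ab) a≢b)

        counts : suc (d + e) ≡ suc v
        counts = trans (cong (λ k → suc (k + e)) (count-one (neighbour Δ) l ll onlyL)) (cong suc e+1≡v)

      result : Shape Δ (suc v) (d + e)
      result with neighbour Δ u Bool.≟ true
      ... | yes lu  = cone lu
      ... | no  ¬lu with FinP.any? (λ k → (isVertex Γ k Bool.≟ true) ×-dec (¬? (k FinP.≟ u) ×-dec ¬? (k FinP.≟ l)))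
      ...   | yes (l′ , vl′ , l′≢u , l′≢l) = secondLeaf l′ vl′ l′≢u l′≢l
      ...   | no  noOtherLeaf = path ¬lu onlyLeaf
        where
        onlyLeaf : ∀ k → isVertex Γ k ≡ true → k ≢ u → k ≡ l
        onlyLeaf k vk k≢u with k FinP.≟ l
        ... | yes k≡l = k≡l
        ... | no  k≢l = ⊥-elim (noOtherLeaf (k , vk , k≢u , k≢l))

    result : Shape Δ (suc v) (d + e)
    result with FinP.any? (λ l → (neighbour Δ l Bool.≟ true) ×-dec ¬? (l FinP.≟ u))
    ... | no  noLeafJoined   = newLeaf noLeafJoined
    ... | yes (l , ll , l≢u) = JoinedToLeaf.result l ll l≢u

  -- If Γ has no centre, an edge ab of Γ gives a neighbour j₀ of 0; were j₀ the only
  -- one, it would be a centre of Γ.  So d ≥ 2, and Δ has no centre either.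
  fromSpread : NoCentre Γ → 1 ≤ e → 3 * v ≤ 2 * e + 4 → v ≤ suc e → Shape Δ (suc v) (d + e)
  fromSpread noCentreΓ 1≤e ineq conn with edgeCount-witness Γ 1≤e
  ... | a , b , a≢b , ab =
    spread noCentre (≤-trans 1≤e (m≤n+m e d)) (spread-grow d e v ineq 2≤d) (connected-grow d e v conn (≤-trans (s≤s z≤n) 2≤d))
    where
    joinedEnd : Σ (Fin n) λ j → neighbour Δ j ≡ true
    joinedEnd with edge-meets-neighbour a b a≢b ab
    ... | inj₁ la = a , la
    ... | inj₂ lb = b , lb

    2≤d : 2 ≤ d
    2≤d with joinedEnd
    ... | j₀ , lj₀ with FinP.any? (λ j → (neighbour Δ j Bool.≟ true) ×-dec ¬? (j FinP.≟ j₀))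
    ...   | yes (j , lj , j≢j₀) = count-two (neighbour Δ) j j₀ lj lj₀ j≢j₀
    ...   | no  noOther = ⊥-elim (noCentreΓ j₀ (neighbour-vertex sc j₀ lj₀ , onEdges))
      where
      onEdges : ∀ x y → x ≢ y → IsFace Γ (edge x y) → x ≡ j₀ ⊎ y ≡ j₀
      onEdges x y x≢y xy = Sum.map (only-at (neighbour Δ) j₀ noOther x) (only-at (neighbour Δ) j₀ noOther y)
                                   (edge-meets-neighbour x y x≢y xy)

    noCentre : NoCentre Δ
    noCentre zero    = zero-not-centre a b a≢b ab
    noCentre (suc z) c = noCentreΓ z (centre-deletion Δ z c)

  result : Shape Γ v e → Shape Δ (suc v) (d + e)
  result (edgeless e≡0)                = fromEdgeless e≡0
  result (star u centreΓ e+1≡v 1≤e)    = FromStar.result u centreΓ e+1≡v 1≤e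
  result (spread noCentreΓ 1≤e ineq conn) = fromSpread noCentreΓ 1≤e ineq conn

shape : ∀ {n} (Δ : Family n) → IsSimplicialComplex Δ → TriangleProperty Δ →
  Shape Δ (vertexCount Δ) (edgeCount Δ)
shape {zero}  Δ sc tp = edgeless refl
shape {suc n} Δ sc tp
  with isVertex Δ zero in v₀ | shape (deletion Δ) (deletion-complex sc) (deletion-triangle Δ tp)
... | false | shapeΓ = shape-absent Δ sc v₀ shapeΓ
... | true  | shapeΓ = AddVertex.result Δ sc tp v₀ shapeΓ

-- A graph on v vertices has at most v(v - 1)/2 edges: adding a vertex of
-- degree d ≤ v to a graph with v vertices and e edges preserves 2e + v ≤ v².
edge-bound-step : ∀ d e v → 2 * e + v ≤ v * v → d ≤ v → 2 * (d + e) + suc v ≤ suc v * suc v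
edge-bound-step d e v bound d≤v = begin
    2 * (d + e) + suc v       ≡⟨ solve 3 (λ d e v → con 2 :* (d :+ e) :+ (con 1 :+ v) := (con 2 :* d :+ (con 2 :* e :+ v)) :+ con 1) refl d e v ⟩
    (2 * d + (2 * e + v)) + 1 ≤⟨ +-monoˡ-≤ 1 (+-mono-≤ (*-monoʳ-≤ 2 d≤v) bound) ⟩
    (2 * v + v * v) + 1       ≡⟨ solve 1 (λ v → (con 2 :* v :+ v :* v) :+ con 1 := (con 1 :+ v) :* (con 1 :+ v)) refl v ⟩
    suc v * suc v             ∎
  where open ≤-Reasoning; open ℕSolver.+-*-Solver

edge-bound : ∀ {n} (Δ : Family n) → IsSimplicialComplex Δ →
  2 * edgeCount Δ + vertexCount Δ ≤ vertexCount Δ * vertexCount Δ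
edge-bound {zero}  Δ sc = z≤n
edge-bound {suc n} Δ sc with isVertex Δ zero in v₀ | edge-bound (deletion Δ) (deletion-complex sc)
... | false | boundΓ =
  subst (λ e → 2 * e + vertexCount (deletion Δ) ≤ vertexCount (deletion Δ) * vertexCount (deletion Δ))
        (sym (edgeCount-absent sc v₀)) boundΓ
... | true  | boundΓ = edge-bound-step (count (neighbour Δ)) (edgeCount (deletion Δ)) (vertexCount (deletion Δ)) boundΓ
                         (count-mono (neighbour Δ) (isVertex (deletion Δ)) (neighbour-vertex sc))

-- Face numbers.  faceCount Δ i counts the faces of size i in the list
-- allSubsets n, which is split by the first coordinate; this relates the
-- face numbers of Δ to those of its deletion and its link at 0.

countᵇ : ∀ {A : Set} → (A → Bool) → List A → ℕ
countᵇ p xs = length (filterᵇ p xs)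

countᵇ-++ : ∀ {A : Set} (p : A → Bool) xs ys → countᵇ p (xs ++ ys) ≡ countᵇ p xs + countᵇ p ys
countᵇ-++ p xs ys = trans (cong length (filter-++ (λ x → T? (p x)) xs ys)) (length-++ (filterᵇ p xs))

countᵇ-map : ∀ {A B : Set} (p : B → Bool) (f : A → B) xs → countᵇ p (map f xs) ≡ countᵇ (λ x → p (f x)) xs
countᵇ-map p f []       = refl
countᵇ-map p f (x ∷ xs) with p (f x)
... | true  = cong suc (countᵇ-map p f xs)
... | false = countᵇ-map p f xs

countᵇ-cong : ∀ {A : Set} (p q : A → Bool) → (∀ x → p x ≡ q x) → ∀ xs → countᵇ p xs ≡ countᵇ q xs
countᵇ-cong p q p≗q []       = refl
countᵇ-cong p q p≗q (x ∷ xs) with p x | q x | p≗q x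
... | true  | true  | _ = cong suc (countᵇ-cong p q p≗q xs)
... | false | false | _ = countᵇ-cong p q p≗q xs

countᵇ-false : ∀ {A : Set} (p : A → Bool) → (∀ x → p x ≡ false) → ∀ xs → countᵇ p xs ≡ 0
countᵇ-false p none []       = refl
countᵇ-false p none (x ∷ xs) rewrite none x = countᵇ-false p none xs

countᵇ-pos : ∀ {A : Set} (p : A → Bool) {x} xs → x ∈ xs → p x ≡ true → 1 ≤ countᵇ p xs
countᵇ-pos p (y ∷ xs) (here refl) px rewrite px = s≤s z≤n
countᵇ-pos p (y ∷ xs) (there x∈xs) px with p y
... | true  = s≤s z≤n
... | false = countᵇ-pos p xs x∈xs px

∈-allSubsets : ∀ {n} (S : Subset n) → S ∈ allSubsets n
∈-allSubsets []               = here refl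
∈-allSubsets {suc n} (true ∷ S)  = ∈-++⁺ˡ (∈-map⁺ (inside ∷_) (∈-allSubsets S))
∈-allSubsets {suc n} (false ∷ S) = ∈-++⁺ʳ (map (inside ∷_) (allSubsets n)) (∈-map⁺ (outside ∷_) (∈-allSubsets S))

link : ∀ {n} → Family (suc n) → Family n
link Δ S = Δ (inside ∷ S)

-- A face of size i + 1 either contains 0 (a face of size i of the link) or not.
faceCount-suc : ∀ {n} (Δ : Family (suc n)) i →
  faceCount Δ (suc i) ≡ faceCount (link Δ) i + faceCount (deletion Δ) (suc i)
faceCount-suc {n} Δ i = trans (countᵇ-++ p (map (inside ∷_) (allSubsets n)) _)
  (cong₂ _+_ (trans (countᵇ-map p (inside ∷_) (allSubsets n))
                    (countᵇ-cong _ _ (λ S → cong (Δ (inside ∷ S) ∧_) (≟-suc ∣ S ∣ i)) (allSubsets n)))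
             (countᵇ-map p (outside ∷_) (allSubsets n)))
  where
  p : Subset (suc n) → Bool
  p S = Δ S ∧ ⌊ ∣ S ∣ ℕ.≟ suc i ⌋

  ≟-suc : ∀ a b → ⌊ suc a ℕ.≟ suc b ⌋ ≡ ⌊ a ℕ.≟ b ⌋
  ≟-suc a b with a ℕ.≟ b | suc a ℕ.≟ suc b
  ... | yes _   | yes _     = refl
  ... | no  _   | no  _     = refl
  ... | yes a≡b | no  sa≢sb = ⊥-elim (sa≢sb (cong suc a≡b))
  ... | no  a≢b | yes sa≡sb = ⊥-elim (a≢b (suc-injective sa≡sb))

-- The empty face does not contain 0.
faceCount-zero : ∀ {n} (Δ : Family (suc n)) → faceCount Δ 0 ≡ faceCount (deletion Δ) 0
faceCount-zero {n} Δ = trans (countᵇ-++ p (map (inside ∷_) (allSubsets n)) _)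
  (cong₂ _+_ (trans (countᵇ-map p (inside ∷_) (allSubsets n))
                    (countᵇ-false _ (λ S → ∧-zeroʳ (Δ (inside ∷ S))) (allSubsets n)))
             (countᵇ-map p (outside ∷_) (allSubsets n)))
  where
  p : Subset (suc n) → Bool
  p S = Δ S ∧ ⌊ ∣ S ∣ ℕ.≟ 0 ⌋

faceCount-empty : ∀ {n} (Δ : Family n) → faceCount Δ 0 ≡ boolToℕ (Δ ∅)
faceCount-empty {zero}  Δ with Δ []
... | true  = refl
... | false = refl
faceCount-empty {suc n} Δ = trans (faceCount-zero Δ) (faceCount-empty (deletion Δ))

faceCount-vertices : ∀ {n} (Δ : Family n) → faceCount Δ 1 ≡ vertexCount Δ
faceCount-vertices {zero}  Δ with Δ []
... | true  = refl
... | false = refl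
faceCount-vertices {suc n} Δ =
  trans (faceCount-suc Δ 0) (cong₂ _+_ (faceCount-empty (link Δ)) (faceCount-vertices (deletion Δ)))

faceCount-edges : ∀ {n} (Δ : Family n) → faceCount Δ 2 ≡ edgeCount Δ
faceCount-edges {zero}  Δ with Δ []
... | true  = refl
... | false = refl
faceCount-edges {suc n} Δ =
  trans (faceCount-suc Δ 1) (cong₂ _+_ (faceCount-vertices (link Δ)) (faceCount-edges (deletion Δ)))

faceCount-pos : ∀ {n} (Δ : Family n) S → IsFace Δ S → 1 ≤ faceCount Δ ∣ S ∣
faceCount-pos {n} Δ S fS =
  countᵇ-pos (λ F → Δ F ∧ ⌊ ∣ F ∣ ℕ.≟ ∣ S ∣ ⌋) (allSubsets n) (∈-allSubsets S) (cong₂ _∧_ fS size-ok)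
  where
  size-ok : ⌊ ∣ S ∣ ℕ.≟ ∣ S ∣ ⌋ ≡ true
  size-ok with ∣ S ∣ ℕ.≟ ∣ S ∣
  ... | yes _ = refl
  ... | no  k≢k = ⊥-elim (k≢k refl)

triangular : ℕ → ℕ
triangular zero    = 0
triangular (suc a) = triangular a + suc a

twice-triangular : ∀ a → 2 * triangular a ≡ a + a * a
twice-triangular zero    = refl
twice-triangular (suc a) = begin
    2 * (triangular a + suc a)     ≡⟨ *-distribˡ-+ 2 (triangular a) (suc a) ⟩
    2 * triangular a + 2 * suc a   ≡⟨ cong (_+ 2 * suc a) (twice-triangular a) ⟩
    a + a * a + 2 * suc a          ≡⟨ solve 1 (λ a → a :+ a :* a :+ con 2 :* (con 1 :+ a) := (con 1 :+ a) :+ (con 1 :+ a) :* (con 1 :+ a)) refl a ⟩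
    suc a + suc a * suc a          ∎
  where open ≡-Reasoning; open ℕSolver.+-*-Solver

-- The pairs (a, b) for which (1, a, b) will turn out to be the h-vector:
-- b = 0, or a/2 ≤ b ≤ a(a + 1)/2.
Admissible : ℕ → ℕ → Set
Admissible a b = b ≡ 0 ⊎ (a ≤ 2 * b × b ≤ triangular a)

-- For a graph without centre, writing v = a + 2 and e = a + b + 1, the
-- inequalities 3v ≤ 2e + 4 and 2e + v ≤ v² become a ≤ 2b and b ≤ a(a + 1)/2.
spread-admissible : ∀ v e → 1 ≤ e → 3 * v ≤ 2 * e + 4 → v ≤ suc e → 2 * e + v ≤ v * v →
  Σ ℕ λ a → Σ ℕ λ b → v ≡ 2 + a × e ≡ 1 + a + b × Admissible a b
spread-admissible zero          e 1≤e _ _ bound with () ← ≤-trans 1≤e (≤-trans (m≤m+n e (e + 0)) (≤-trans (m≤m+n (2 * e) 0) bound))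
spread-admissible (suc zero)    e 1≤e _ _ bound with s≤s () ← ≤-trans (≤-trans (*-monoʳ-≤ 2 1≤e) (m≤m+n (2 * e) 1)) bound
spread-admissible (suc (suc a)) e 1≤e ineq (s≤s a+1≤e) bound = a , b , refl , sym a+1+b≡e , inj₂ (a≤2b , b≤T)
  where
  open ℕSolver.+-*-Solver
  b : ℕ
  b = e ∸ suc a
  a+1+b≡e : suc a + b ≡ e
  a+1+b≡e = m+[n∸m]≡n a+1≤e

  a≤2b : a ≤ 2 * b
  a≤2b = +-cancelˡ-≤ (6 + 2 * a) a (2 * b)
    (subst₂ _≤_ (solve 1 (λ a → con 3 :* (con 2 :+ a) := (con 6 :+ con 2 :* a) :+ a) refl a)
                (solve 2 (λ a b → con 2 :* ((con 1 :+ a) :+ b) :+ con 4 := (con 6 :+ con 2 :* a) :+ con 2 :* b) refl a b)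
                (subst (λ x → 3 * suc (suc a) ≤ 2 * x + 4) (sym a+1+b≡e) ineq))

  b≤T : b ≤ triangular a
  b≤T = *-cancelˡ-≤ 2 (subst (2 * b ≤_) (sym (twice-triangular a)) (+-cancelˡ-≤ (4 + 3 * a) (2 * b) (a + a * a)
    (subst₂ _≤_ (solve 2 (λ a b → con 2 :* ((con 1 :+ a) :+ b) :+ (con 2 :+ a) := (con 4 :+ con 3 :* a) :+ con 2 :* b) refl a b)
                (solve 1 (λ a → (con 2 :+ a) :* (con 2 :+ a) := (con 4 :+ con 3 :* a) :+ (a :+ a :* a)) refl a)
                (subst (λ x → 2 * x + suc (suc a) ≤ suc (suc a) * suc (suc a)) (sym a+1+b≡e) bound))))

graph-counts : ∀ {n} (Δ : Family n) → IsSimplicialComplex Δ → IsMatroid Δ → HasDimension Δ 1 →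
  faceCount Δ 0 ≡ 1 × (Σ ℕ λ a → Σ ℕ λ b → faceCount Δ 1 ≡ 2 + a × faceCount Δ 2 ≡ 1 + a + b × Admissible a b)
graph-counts Δ sc mat ((S , fS , ∣S∣≡2) , _) = empty-face , fromShape (shape Δ sc (matroid-triangle Δ sc mat))
  where
  1≤e : 1 ≤ edgeCount Δ
  1≤e = subst (1 ≤_) (faceCount-edges Δ) (subst (λ k → 1 ≤ faceCount Δ k) ∣S∣≡2 (faceCount-pos Δ S fS))

  empty-face : faceCount Δ 0 ≡ 1
  empty-face = trans (faceCount-empty Δ) (cong boolToℕ (face-⊆ sc {S} {∅} ⊥⊆ fS))

  fromShape : Shape Δ (vertexCount Δ) (edgeCount Δ) →
    Σ ℕ λ a → Σ ℕ λ b → faceCount Δ 1 ≡ 2 + a × faceCount Δ 2 ≡ 1 + a + b × Admissible a b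
  fromShape (edgeless e≡0) with () ← subst (1 ≤_) e≡0 1≤e
  fromShape (star _ _ e+1≡v _) with edgeCount Δ | faceCount-edges Δ | e+1≡v | 1≤e
  ... | suc a | c₂≡e | e+1≡v′ | _ =
    a , 0 , trans (faceCount-vertices Δ) (sym e+1≡v′) , trans c₂≡e (cong suc (sym (+-identityʳ a))) , inj₁ refl
  fromShape (spread _ 1≤e′ ineq conn)
    with spread-admissible (vertexCount Δ) (edgeCount Δ) 1≤e′ ineq conn (edge-bound Δ sc)
  ... | a , b , v≡ , e≡ , adm = a , b , trans (faceCount-vertices Δ) v≡ , trans (faceCount-edges Δ) e≡ , adm

-- The coefficients of f₋₁ (1 - t)² + f₀ t (1 - t) + f₁ t²: the h-vector of a
-- one-dimensional complex with face numbers (f₋₁, f₀, f₁).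
graphH : ℤ.ℤ → ℤ.ℤ → ℤ.ℤ → List ℤ.ℤ
graphH f₋₁ f₀ f₁ = f₋₁ ∷ f₀ ℤ.- ℤ.+ 2 ℤ.* f₋₁ ∷ f₁ ℤ.- f₀ ℤ.+ f₋₁ ∷ []

hPoly-dim1 : ∀ {n} (Δ : Family n) → hPoly Δ 1 ≡ graphH (ℤ.+ faceCount Δ 0) (ℤ.+ faceCount Δ 1) (ℤ.+ faceCount Δ 2)
hPoly-dim1 Δ = expand (ℤ.+ faceCount Δ 0) (ℤ.+ faceCount Δ 1) (ℤ.+ faceCount Δ 2)
  where
  open ℤSolver.+-*-Solver
  expand : ∀ f₋₁ f₀ f₁ →
    scale f₋₁ (pow tP 0 ⊛ pow oneMinusT 2) ⊕ (scale f₀ (pow tP 1 ⊛ pow oneMinusT 1) ⊕ scale f₁ (pow tP 2))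
      ≡ graphH f₋₁ f₀ f₁
  expand f₋₁ f₀ f₁ =
    cong₂ _∷_ (solve 3 (λ x y z → x :* con (ℤ.+ 1) :+ (y :* con (ℤ.+ 0) :+ z :* con (ℤ.+ 0)) := x) refl f₋₁ f₀ f₁)
    (cong₂ _∷_ (solve 3 (λ x y z → x :* con (ℤ.- ℤ.+ 2) :+ (y :* con (ℤ.+ 1) :+ z :* con (ℤ.+ 0)) := y :- con (ℤ.+ 2) :* x) refl f₋₁ f₀ f₁)
    (cong₂ _∷_ (solve 3 (λ x y z → x :* con (ℤ.+ 1) :+ (y :* con (ℤ.- ℤ.+ 1) :+ z :* con (ℤ.+ 1)) := z :- y :+ x) refl f₋₁ f₀ f₁)
    refl))

hPoly-graph : ∀ {n} (Δ : Family n) a b → faceCount Δ 0 ≡ 1 → faceCount Δ 1 ≡ 2 + a → faceCount Δ 2 ≡ 1 + a + b →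
  hPoly Δ 1 ≡ ℤ.+ 1 ∷ ℤ.+ a ∷ ℤ.+ b ∷ []
hPoly-graph Δ a b c₀≡ c₁≡ c₂≡ = trans (hPoly-dim1 Δ) (specialise (faceCount Δ 0) (faceCount Δ 1) (faceCount Δ 2) c₀≡ c₁≡ c₂≡)
  where
  open ℤSolver.+-*-Solver
  specialise : ∀ x y z → x ≡ 1 → y ≡ 2 + a → z ≡ 1 + a + b → graphH (ℤ.+ x) (ℤ.+ y) (ℤ.+ z) ≡ ℤ.+ 1 ∷ ℤ.+ a ∷ ℤ.+ b ∷ []
  specialise _ _ _ refl refl refl =
    cong₂ _∷_ refl
    (cong₂ _∷_ (solve 1 (λ A → (con (ℤ.+ 2) :+ A) :- con (ℤ.+ 2) :* con (ℤ.+ 1) := A) refl (ℤ.+ a))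
    (cong₂ _∷_ (solve 2 (λ A B → (con (ℤ.+ 1) :+ A :+ B) :- (con (ℤ.+ 2) :+ A) :+ con (ℤ.+ 1) := B) refl (ℤ.+ a) (ℤ.+ b))
    refl))

one : ∀ m → Monomial m
one m = replicate m 0

var : ∀ {m} → Fin m → Monomial m
var {suc m} zero    = 1 ∷ one m
var         (suc k) = 0 ∷ var k

exponent₀ : ∀ {m} → Monomial (suc m) → ℕ
exponent₀ (x ∷ _) = x

deg-one : ∀ m → deg (one m) ≡ 0
deg-one zero    = refl
deg-one (suc m) = deg-one m

deg-var : ∀ {m} (k : Fin m) → deg (var k) ≡ 1
deg-var {suc m} zero    = cong suc (deg-one m)
deg-var         (suc k) = deg-var k

var-injective : ∀ {m} {k l : Fin m} → var k ≡ var l → k ≡ l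
var-injective {k = zero}  {zero}  _ = refl
var-injective {k = zero}  {suc l} ()
var-injective {k = suc k} {zero}  ()
var-injective {k = suc k} {suc l} e = cong suc (var-injective (VecP.∷-injectiveʳ e))

∣ₘ-refl : ∀ {m} (u : Monomial m) → u ∣ₘ u
∣ₘ-refl []      = []
∣ₘ-refl (x ∷ u) = ≤-refl ∷ ∣ₘ-refl u

deg0⇒one : ∀ {m} (u : Monomial m) → deg u ≡ 0 → u ≡ one m
deg0⇒one []         _ = refl
deg0⇒one (zero ∷ u) e = cong (0 ∷_) (deg0⇒one u e)

deg0-∣ₘ : ∀ {m} (u w : Monomial m) → deg u ≡ 0 → u ∣ₘ w
deg0-∣ₘ []         []      _ = []
deg0-∣ₘ (zero ∷ u) (y ∷ w) e = z≤n ∷ deg0-∣ₘ u w e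

deg1⇒var : ∀ {m} (u : Monomial m) → deg u ≡ 1 → Σ (Fin m) λ k → u ≡ var k
deg1⇒var (zero ∷ u) e with deg1⇒var u e
... | k , refl = suc k , refl
deg1⇒var (suc zero ∷ u)    e = zero , cong (1 ∷_) (deg0⇒one u (suc-injective e))
deg1⇒var (suc (suc x) ∷ u) ()

∣ₘ-one : ∀ {m} (v : Monomial m) → v ∣ₘ one m → v ≡ one m
∣ₘ-one []      []        = refl
∣ₘ-one (x ∷ v) (z≤n ∷ d) = cong (0 ∷_) (∣ₘ-one v d)

∣ₘ-var : ∀ {m} (k : Fin m) (v : Monomial m) → v ∣ₘ var k → v ≡ one m ⊎ v ≡ var k
∣ₘ-var zero    (zero ∷ v)     (z≤n ∷ d)     = inj₁ (cong (0 ∷_) (∣ₘ-one v d))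
∣ₘ-var zero    (suc zero ∷ v) (s≤s z≤n ∷ d) = inj₂ (cong (1 ∷_) (∣ₘ-one v d))
∣ₘ-var (suc k) (zero ∷ v)     (z≤n ∷ d) with ∣ₘ-var k v d
... | inj₁ e = inj₁ (cong (0 ∷_) e)
... | inj₂ e = inj₂ (cong (0 ∷_) e)

countDeg : ∀ {m} → List (Monomial m) → ℕ → ℕ
countDeg L i = length (filter (λ u → deg u ℕ.≟ i) L)

countDeg-++ : ∀ {m} (xs ys : List (Monomial m)) i → countDeg (xs ++ ys) i ≡ countDeg xs i + countDeg ys i
countDeg-++ xs ys i = trans (cong length (filter-++ (λ u → deg u ℕ.≟ i) xs ys)) (length-++ (filter (λ u → deg u ℕ.≟ i) xs))

countDeg-map0 : ∀ {m} (L : List (Monomial m)) i → countDeg (map (0 ∷_) L) i ≡ countDeg L i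
countDeg-map0 []      i = refl
countDeg-map0 (u ∷ L) i with deg u ℕ.≡ᵇ i
... | true  = cong suc (countDeg-map0 L i)
... | false = countDeg-map0 L i

countDeg-∷-yes : ∀ {m} (x : Monomial m) xs i → deg x ≡ i → countDeg (x ∷ xs) i ≡ suc (countDeg xs i)
countDeg-∷-yes x xs i e = cong length (filter-accept (λ u → deg u ℕ.≟ i) {x} {xs} e)

countDeg-∷-no : ∀ {m} (x : Monomial m) xs i → deg x ≢ i → countDeg (x ∷ xs) i ≡ countDeg xs i
countDeg-∷-no x xs i ne = cong length (filter-reject (λ u → deg u ℕ.≟ i) {x} {xs} ne)

countDeg-all : ∀ {m} (xs : List (Monomial m)) i → All (λ u → deg u ≡ i) xs → countDeg xs i ≡ length xs
countDeg-all []       i []       = refl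
countDeg-all (x ∷ xs) i (p ∷ ps) = trans (countDeg-∷-yes x xs i p) (cong suc (countDeg-all xs i ps))

countDeg-none : ∀ {m} (xs : List (Monomial m)) i → All (λ u → deg u ≢ i) xs → countDeg xs i ≡ 0
countDeg-none []       i []       = refl
countDeg-none (x ∷ xs) i (p ∷ ps) = trans (countDeg-∷-no x xs i p) (countDeg-none xs i ps)

Closed : ∀ {m} → List (Monomial m) → Set
Closed L = ∀ u v → u ∈ L → v ∣ₘ u → v ∈ L

-- Adjoining a new first variable x₀ to a list L of monomials in m variables:
-- the old monomials (with exponent 0 for x₀), x₀ itself, and the chosen new
-- quadrics: x₀² (if s) and x₀ x_k for k in ks.

square : ∀ {m} → Bool → List (Monomial (suc m))
square {m} true  = (2 ∷ one m) ∷ []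
square     false = []

x₀-times : ∀ {m} → Fin m → Monomial (suc m)
x₀-times k = 1 ∷ var k

newQuadrics : ∀ {m} → Bool → List (Fin m) → List (Monomial (suc m))
newQuadrics s ks = square s ++ map x₀-times ks

newMonomials : ∀ {m} → Bool → List (Fin m) → List (Monomial (suc m))
newMonomials {m} s ks = (1 ∷ one m) ∷ newQuadrics s ks

adjoin : ∀ {m} → List (Monomial m) → Bool → List (Fin m) → List (Monomial (suc m))
adjoin L s ks = map (0 ∷_) L ++ newMonomials s ks

module Adjoin {m} (L : List (Monomial m)) (ks : List (Fin m)) where

  inOld : ∀ s {u} → u ∈ L → (0 ∷ u) ∈ adjoin L s ks
  inOld s u∈L = ∈-++⁺ˡ (∈-map⁺ (0 ∷_) u∈L)

  inNew : ∀ s {u} → u ∈ newMonomials s ks → u ∈ adjoin L s ks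
  inNew s u∈new = ∈-++⁺ʳ (map (0 ∷_) L) u∈new

  quadric-deg : ∀ s w → w ∈ newQuadrics s ks → deg w ≡ 2
  quadric-deg true  w (here refl) = cong (λ k → 2 + k) (deg-one m)
  quadric-deg true  w (there w∈) with ∈-map⁻ x₀-times w∈
  ... | k , _ , refl = cong suc (deg-var k)
  quadric-deg false w w∈ with ∈-map⁻ x₀-times w∈
  ... | k , _ , refl = cong suc (deg-var k)

  new-exponent₀ : ∀ s w → w ∈ newMonomials s ks → 1 ≤ exponent₀ w
  new-exponent₀ s     w (here refl)          = s≤s z≤n
  new-exponent₀ true  w (there (here refl))  = s≤s z≤n
  new-exponent₀ true  w (there (there w∈)) with ∈-map⁻ x₀-times w∈
  ... | k , _ , refl = s≤s z≤n
  new-exponent₀ false w (there w∈) with ∈-map⁻ x₀-times w∈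
  ... | k , _ , refl = s≤s z≤n

  new-deg≤2 : ∀ s w → w ∈ newMonomials s ks → deg w ≤ 2
  new-deg≤2 s w (here refl) = ≤-trans (≤-reflexive (cong suc (deg-one m))) (s≤s z≤n)
  new-deg≤2 s w (there w∈)  = ≤-reflexive (quadric-deg s w w∈)

  -- Closure under divisors: a divisor of a new monomial is 1, x₀, x_k,
  -- x₀ x_k or x₀², all of which are present when L contains 1 and the x_k.
  module _ (closedL : Closed L) (one∈L : one m ∈ L) (vars∈L : ∀ k → var k ∈ L) where

    closed-old : ∀ s u v → u ∈ L → v ∣ₘ (0 ∷ u) → v ∈ adjoin L s ks
    closed-old s u (zero ∷ v) u∈L (z≤n ∷ v∣u) = inOld s (closedL u v u∈L v∣u)

    closed-x₀ : ∀ s v → v ∣ₘ (1 ∷ one m) → v ∈ adjoin L s ks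
    closed-x₀ s (zero ∷ v)     (z≤n ∷ v∣1)     rewrite ∣ₘ-one v v∣1 = inOld s one∈L
    closed-x₀ s (suc zero ∷ v) (s≤s z≤n ∷ v∣1) rewrite ∣ₘ-one v v∣1 = inNew s (here refl)

    closed-square : ∀ v → v ∣ₘ (2 ∷ one m) → v ∈ adjoin L true ks
    closed-square (zero ∷ v)           (z≤n ∷ v∣1)           rewrite ∣ₘ-one v v∣1 = inOld true one∈L
    closed-square (suc zero ∷ v)       (s≤s z≤n ∷ v∣1)       rewrite ∣ₘ-one v v∣1 = inNew true (here refl)
    closed-square (suc (suc zero) ∷ v) (s≤s (s≤s z≤n) ∷ v∣1) rewrite ∣ₘ-one v v∣1 = inNew true (there (here refl))

    closed-x₀-times : ∀ s k → x₀-times k ∈ adjoin L s ks → ∀ v → v ∣ₘ x₀-times k → v ∈ adjoin L s ks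
    closed-x₀-times s k _   (zero ∷ v) (z≤n ∷ v∣xₖ) with ∣ₘ-var k v v∣xₖ
    ... | inj₁ refl = inOld s one∈L
    ... | inj₂ refl = inOld s (vars∈L k)
    closed-x₀-times s k x∈ (suc zero ∷ v) (s≤s z≤n ∷ v∣xₖ) with ∣ₘ-var k v v∣xₖ
    ... | inj₁ refl = inNew s (here refl)
    ... | inj₂ refl = x∈

    closed : ∀ s → Closed (adjoin L s ks)
    closed s u v u∈ v∣u with ∈-++⁻ (map (0 ∷_) L) u∈
    ... | inj₁ u∈old with ∈-map⁻ (0 ∷_) u∈old
    ...   | u′ , u′∈L , refl = closed-old s u′ v u′∈L v∣u
    closed s u v u∈ v∣u | inj₂ (here refl) = closed-x₀ s v v∣u
    closed true  u v u∈ v∣u | inj₂ (there (here refl)) = closed-square v v∣u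
    closed true  u v u∈ v∣u | inj₂ (there (there w∈)) with ∈-map⁻ x₀-times w∈
    ... | k , _ , refl = closed-x₀-times true k u∈ v v∣u
    closed false u v u∈ v∣u | inj₂ (there w∈) with ∈-map⁻ x₀-times w∈
    ... | k , _ , refl = closed-x₀-times false k u∈ v v∣u

  unique-quadrics : ∀ s → Unique ks → Unique (newQuadrics s ks)
  unique-quadrics false uniqueKs = UniqueP.map⁺ (λ e → var-injective (VecP.∷-injectiveʳ e)) uniqueKs
  unique-quadrics true  uniqueKs =
    All.tabulate (λ {w} w∈ x₀²≡w → 2≢1 (cong exponent₀ (trans x₀²≡w (proj₂ (proj₂ (∈-map⁻ x₀-times w∈))))))
    ∷ UniqueP.map⁺ (λ e → var-injective (VecP.∷-injectiveʳ e)) uniqueKs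
    where
    2≢1 : 2 ≢ 1
    2≢1 ()

  unique : ∀ s → Unique L → Unique ks → Unique (adjoin L s ks)
  unique s uniqueL uniqueKs = UniqueP.++⁺ (UniqueP.map⁺ VecP.∷-injectiveʳ uniqueL) uniqueNew disjoint
    where
    uniqueNew : Unique (newMonomials s ks)
    uniqueNew = All.tabulate (λ {w} w∈ x₀≡w → 1+n≢n {1} (sym (trans (cong suc (sym (deg-one m)))
                                                     (trans (cong deg x₀≡w) (quadric-deg s w w∈)))))
                ∷ unique-quadrics s uniqueKs
    disjoint : ∀ {v} → ¬ (v ∈ map (0 ∷_) L × v ∈ newMonomials s ks)
    disjoint {v} (v∈old , v∈new) with ∈-map⁻ (0 ∷_) v∈old
    ... | _ , _ , refl with new-exponent₀ s _ v∈new
    ...   | ()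

  vars : ∀ s → (∀ k → var k ∈ L) → ∀ k → var k ∈ adjoin L s ks
  vars s vars∈L zero    = inNew s (here refl)
  vars s vars∈L (suc k) = inOld s (vars∈L k)

  count₀ : ∀ s → countDeg (adjoin L s ks) 0 ≡ countDeg L 0
  count₀ s = trans (countDeg-++ (map (0 ∷_) L) (newMonomials s ks) 0)
    (trans (cong₂ _+_ (countDeg-map0 L 0)
      (trans (countDeg-∷-no (1 ∷ one m) (newQuadrics s ks) 0 (λ e → 1+n≢0 (trans (cong suc (sym (deg-one m))) e)))
             (countDeg-none (newQuadrics s ks) 0 (All.tabulate λ {w} w∈ e → 1+n≢0 {1} (trans (sym (quadric-deg s w w∈)) e)))))
      (+-identityʳ _))

  count₁ : ∀ s → countDeg (adjoin L s ks) 1 ≡ suc (countDeg L 1)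
  count₁ s = trans (countDeg-++ (map (0 ∷_) L) (newMonomials s ks) 1)
    (trans (cong₂ _+_ (countDeg-map0 L 1)
      (trans (countDeg-∷-yes (1 ∷ one m) (newQuadrics s ks) 1 (cong suc (deg-one m)))
             (cong suc (countDeg-none (newQuadrics s ks) 1 (All.tabulate λ {w} w∈ e → 1+n≢n {1} (trans (sym (quadric-deg s w w∈)) e))))))
      (+-comm _ 1))

  length-quadrics : ∀ s → length (newQuadrics s ks) ≡ boolToℕ s + length ks
  length-quadrics true  = cong suc (length-map x₀-times ks)
  length-quadrics false = length-map x₀-times ks

  count₂ : ∀ s → countDeg (adjoin L s ks) 2 ≡ countDeg L 2 + (boolToℕ s + length ks)
  count₂ s = trans (countDeg-++ (map (0 ∷_) L) (newMonomials s ks) 2)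
    (cong₂ _+_ (countDeg-map0 L 2)
      (trans (countDeg-∷-no (1 ∷ one m) (newQuadrics s ks) 2 (λ e → 1+n≢n {1} (sym (trans (cong suc (sym (deg-one m))) e))))
             (trans (countDeg-all (newQuadrics s ks) 2 (All.tabulate λ {w} w∈ → quadric-deg s w w∈)) (length-quadrics s))))

record Ideal (D m b : ℕ) : Set where
  field
    L       : List (Monomial m)
    unique  : Unique L
    closed  : Closed L
    one∈    : one m ∈ L
    vars∈   : ∀ k → var k ∈ L
    deg≤    : ∀ u → u ∈ L → deg u ≤ D
    count₀  : countDeg L 0 ≡ 1
    count₁  : countDeg L 1 ≡ m
    count₂  : countDeg L 2 ≡ b

trivialIdeal : ∀ D → Ideal D 0 0
trivialIdeal D = record
  { L = [] ∷ [] ; unique = [] ∷ [] ; closed = λ { u [] (here refl) [] → here refl }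
  ; one∈ = here refl ; vars∈ = λ () ; deg≤ = λ { u (here refl) → z≤n }
  ; count₀ = refl ; count₁ = refl ; count₂ = refl }

adjoinIdeal : ∀ {D m b} (I : Ideal D m b) (s : Bool) (ks : List (Fin m)) → Unique ks →
  (∀ w → w ∈ newMonomials s ks → deg w ≤ D) → Ideal D (suc m) (b + (boolToℕ s + length ks))
adjoinIdeal {D} {m} {b} I s ks uniqueKs newDeg≤ = record
  { L       = adjoin L s ks
  ; unique  = A.unique s unique uniqueKs
  ; closed  = A.closed closed one∈ vars∈ s
  ; one∈    = A.inOld s one∈
  ; vars∈   = A.vars s vars∈
  ; deg≤    = deg≤′
  ; count₀  = trans (A.count₀ s) count₀
  ; count₁  = trans (A.count₁ s) (cong suc count₁)
  ; count₂  = trans (A.count₂ s) (cong (_+ (boolToℕ s + length ks)) count₂) }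
  where
  open Ideal I
  module A = Adjoin L ks
  deg≤′ : ∀ u → u ∈ adjoin L s ks → deg u ≤ D
  deg≤′ u u∈ with ∈-++⁻ (map (0 ∷_) L) u∈
  ... | inj₁ u∈old with ∈-map⁻ (0 ∷_) u∈old
  ...   | u′ , u′∈L , refl = deg≤ u′ u′∈L
  deg≤′ u u∈ | inj₂ u∈new = newDeg≤ u u∈new

linearIdeal : ∀ m → Ideal 1 m 0
linearIdeal zero    = trivialIdeal 1
linearIdeal (suc m) = adjoinIdeal (linearIdeal m) false [] [] (λ { w (here refl) → ≤-reflexive (cong suc (deg-one m)) })

Covered : ∀ {m} → List (Monomial m) → Set
Covered {m} L = ∀ k → Σ (Monomial m) λ w → w ∈ L × deg w ≡ 2 × var k ∣ₘ w

CoveredIdeal : ℕ → ℕ → Set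
CoveredIdeal m b = Σ (Ideal 2 m b) λ I → Covered (Ideal.L I)

firstVars : ∀ t m → t ≤ m → List (Fin m)
firstVars zero    m       _       = []
firstVars (suc t) (suc m) (s≤s t≤m) = zero ∷ map suc (firstVars t m t≤m)

firstVars-length : ∀ t m t≤m → length (firstVars t m t≤m) ≡ t
firstVars-length zero    m       _         = refl
firstVars-length (suc t) (suc m) (s≤s t≤m) = cong suc (trans (length-map suc (firstVars t m t≤m)) (firstVars-length t m t≤m))

firstVars-unique : ∀ t m t≤m → Unique (firstVars t m t≤m)
firstVars-unique zero    m       _         = []
firstVars-unique (suc t) (suc m) (s≤s t≤m) =
  All.tabulate (λ {k} k∈ 0≡k → FinP.0≢1+n (trans 0≡k (proj₂ (proj₂ (∈-map⁻ suc k∈)))))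
  ∷ UniqueP.map⁺ FinP.suc-injective (firstVars-unique t m t≤m)

∣ₘ-one-var : ∀ {m} (k : Fin m) → one m ∣ₘ var k
∣ₘ-one-var {m} k = deg0-∣ₘ (one m) (var k) (deg-one m)

-- Adjoin x₀ with the t + 1 quadrics x₀², x₀x₁, …, x₀x_t (t ≤ m);
-- x₀ is covered by x₀².
extend-cone : ∀ {m b} → CoveredIdeal m b → ∀ t → t ≤ m → CoveredIdeal (suc m) (b + suc t)
extend-cone {m} {b} (I , covered) t t≤m =
  subst (λ x → CoveredIdeal (suc m) (b + suc x)) (firstVars-length t m t≤m) (I′ , covered′)
  where
  ks : List (Fin m)
  ks = firstVars t m t≤m

  I′ : Ideal 2 (suc m) (b + (1 + length ks))
  I′ = adjoinIdeal I true ks (firstVars-unique t m t≤m) (Adjoin.new-deg≤2 (Ideal.L I) ks true)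
  covered′ : Covered (Ideal.L I′)
  covered′ zero with Adjoin.inNew (Ideal.L I) ks true (there (here refl))
  ... | x₀²∈ = 2 ∷ one m , x₀²∈ , cong (λ k → 2 + k) (deg-one m) , s≤s z≤n ∷ ∣ₘ-refl (one m)
  covered′ (suc k) with covered k
  ... | w , w∈ , deg-w , xₖ∣w = 0 ∷ w , Adjoin.inOld (Ideal.L I) ks true w∈ , deg-w , z≤n ∷ xₖ∣w

-- Adjoin two variables x, y with the single quadric xy, which covers both.
extend-pair : ∀ {m b} → CoveredIdeal m b → CoveredIdeal (suc (suc m)) (suc b)
extend-pair {m} {b} (I , covered) = subst (CoveredIdeal (suc (suc m))) b+0+1≡b+1 (I″ , covered′)
  where
  I′ : Ideal 2 (suc m) (b + (0 + 0))
  I′ = adjoinIdeal I false [] [] (λ { w (here refl) → ≤-trans (≤-reflexive (cong suc (deg-one m))) (s≤s z≤n) })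

  L′ : List (Monomial (suc m))
  L′ = Ideal.L I′

  I″ : Ideal 2 (suc (suc m)) (b + (0 + 0) + (0 + 1))
  I″ = adjoinIdeal I′ false (zero ∷ []) ([] ∷ []) (Adjoin.new-deg≤2 L′ (zero ∷ []) false)
  b+0+1≡b+1 : b + (0 + 0) + (0 + 1) ≡ suc b
  b+0+1≡b+1 = trans (cong (_+ 1) (+-identityʳ b)) (+-comm b 1)
  xy∈ : x₀-times zero ∈ Ideal.L I″
  xy∈ = Adjoin.inNew L′ (zero ∷ []) false (there (here refl))
  covered′ : Covered (Ideal.L I″)
  covered′ zero          = x₀-times zero , xy∈ , cong suc (deg-var {suc m} zero) , s≤s z≤n ∷ ∣ₘ-one-var zero
  covered′ (suc zero)    = x₀-times zero , xy∈ , cong suc (deg-var {suc m} zero) , z≤n ∷ ∣ₘ-refl (var zero)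
  covered′ (suc (suc k)) with covered k
  ... | w , w∈ , deg-w , xₖ∣w =
    0 ∷ 0 ∷ w , Adjoin.inOld L′ (zero ∷ []) false (Adjoin.inOld (Ideal.L I) [] false w∈) , deg-w , z≤n ∷ z≤n ∷ xₖ∣w

Realisable : ℕ → Set
Realisable a = ∀ b → a ≤ 2 * b → b ≤ triangular a → CoveredIdeal a b

triangular-≥ : ∀ a → a ≤ triangular a
triangular-≥ zero    = z≤n
triangular-≥ (suc a) = m≤n+m (suc a) (triangular a)

-- From a variables to a + 1: with c = triangular a,
--  * b > c:  b = c + r + 1 with r ≤ a; cone of size r over the full ideal with c quadrics;
--  * b ≤ c and a + 2 ≤ 2b: cone of size 0 over (a, b - 1);
--  * otherwise a + 1 = 2b: a pair over (a - 1, b - 1), needing the case a - 1.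
realise-step : ∀ a → Realisable a → (∀ a′ → a ≡ suc a′ → Realisable a′) → Realisable (suc a)
realise-step a realise-a realise-pred b a+1≤2b b≤T with b ℕ.≤? triangular a
... | no b≰c = subst (CoveredIdeal (suc a)) c+r+1≡b (extend-cone full r r≤a)
  where
  full : CoveredIdeal a (triangular a)
  full = realise-a (triangular a) (≤-trans (triangular-≥ a) (m≤m+n (triangular a) _)) ≤-refl
  r : ℕ
  r = b ∸ suc (triangular a)
  c+r+1≡b : triangular a + suc r ≡ b
  c+r+1≡b = trans (+-suc (triangular a) r) (m+[n∸m]≡n (≰⇒> b≰c))
  r≤a : r ≤ a
  r≤a = ≤-pred (+-cancelˡ-≤ (triangular a) (suc r) (suc a) (subst (_≤ triangular a + suc a) (sym c+r+1≡b) b≤T))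
... | yes b≤c with suc (suc a) ℕ.≤? 2 * b
realise-step a realise-a realise-pred zero       a+1≤2b b≤T | yes b≤c | yes ()
realise-step a realise-a realise-pred (suc b′)   a+1≤2b b≤T | yes b≤c | yes a+2≤2b =
  subst (CoveredIdeal (suc a)) (+-comm b′ 1) (extend-cone (realise-a b′ a≤2b′ (≤-trans (n≤1+n b′) b≤c)) 0 z≤n)
  where
  a≤2b′ : a ≤ 2 * b′
  a≤2b′ = ≤-pred (≤-pred (subst (suc (suc a) ≤_) (*-suc 2 b′) a+2≤2b))
realise-step a realise-a realise-pred zero       () b≤T | yes b≤c | no a+2≰2b
realise-step a realise-a realise-pred (suc b′)   a+1≤2b b≤T | yes b≤c | no a+2≰2b =
  subst (λ x → CoveredIdeal (suc x) (suc b′)) (sym a≡2b′+1) (extend-pair smaller)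
  where
  a≡2b′+1 : a ≡ suc (2 * b′)
  a≡2b′+1 = sym (suc-injective (trans (sym (*-suc 2 b′)) (≤-antisym (≤-pred (≰⇒> a+2≰2b)) a+1≤2b)))
  smaller : CoveredIdeal (2 * b′) b′
  smaller = realise-pred (2 * b′) a≡2b′+1 b′ ≤-refl (≤-trans (m≤m+n b′ (b′ + 0)) (triangular-≥ (2 * b′)))

realise : ∀ a → Realisable a
realise zero b _ b≤0 with n≤0⇒n≡0 b≤0
... | refl = trivialIdeal 2 , λ ()
realise (suc zero)    = realise-step zero (realise zero) (λ _ ())
realise (suc (suc a)) = realise-step (suc a) (realise (suc a)) (λ a′ e → subst Realisable (suc-injective e) (realise a))

-- Purity: in an ideal of degree ≤ D where every monomial of degree < D has a
-- multiple of larger degree, the maximal monomials are exactly of degree D.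
HasLargerMultiples : ∀ {m} → List (Monomial m) → ℕ → Set
HasLargerMultiples {m} L D = ∀ u → u ∈ L → deg u < D → Σ (Monomial m) λ w → w ∈ L × u ∣ₘ w × deg u < deg w

ideal-pure : ∀ {D m b} (I : Ideal D m b) → HasLargerMultiples (Ideal.L I) D → IsPureOrderIdeal (Ideal.L I) D
ideal-pure {D} {m} I larger = unique , (one m , one∈) , closed , maximal-deg
  where
  open Ideal I
  maximal-deg : ∀ u → u ∈ L → (∀ v → v ∈ L → u ∣ₘ v → v ≡ u) → deg u ≡ D
  maximal-deg u u∈ maximal with m≤n⇒m<n∨m≡n (deg≤ u u∈)
  ... | inj₂ deg-u≡D = deg-u≡D
  ... | inj₁ deg-u<D with larger u u∈ deg-u<D
  ...   | w , w∈ , u∣w , deg-u<deg-w = ⊥-elim (<-irrefl (cong deg (sym (maximal w w∈ u∣w))) deg-u<deg-w)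

one-below-var : ∀ {D m b} (I : Ideal D (suc m) b) u → deg u ≡ 0 →
  Σ (Monomial (suc m)) λ w → w ∈ Ideal.L I × u ∣ₘ w × deg u < deg w
one-below-var {m = m} I u deg-u≡0 =
  var zero , Ideal.vars∈ I zero , deg0-∣ₘ u (var zero) deg-u≡0 , subst₂ _<_ (sym deg-u≡0) (sym (deg-var {suc m} zero)) (s≤s z≤n)

linear-larger : ∀ m → HasLargerMultiples (Ideal.L (linearIdeal (suc m))) 1
linear-larger m u u∈ (s≤s deg-u≤0) = one-below-var (linearIdeal (suc m)) u (n≤0⇒n≡0 deg-u≤0)

covered-larger : ∀ {m b} (I : Ideal 2 (suc m) b) → Covered (Ideal.L I) → HasLargerMultiples (Ideal.L I) 2
covered-larger I covered u u∈ (s≤s deg-u≤1) with m≤n⇒m<n∨m≡n deg-u≤1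
... | inj₁ (s≤s deg-u≤0) = one-below-var I u (n≤0⇒n≡0 deg-u≤0)
... | inj₂ deg-u≡1 with deg1⇒var u deg-u≡1
...   | k , refl with covered k
...     | w , w∈ , deg-w≡2 , xₖ∣w = w , w∈ , xₖ∣w , subst₂ _<_ (sym deg-u≡1) (sym deg-w≡2) ≤-refl

pure-1 : IsPureOSequence (ℤ.+ 1 ∷ [])
pure-1 = 0 , Ideal.L I , 0 , ideal-pure I (λ u u∈ ()) , refl
  where
  I : Ideal 0 0 0
  I = trivialIdeal 0

pure-1a : ∀ a → IsPureOSequence (ℤ.+ 1 ∷ ℤ.+ suc a ∷ [])
pure-1a a = suc a , L , 1 , ideal-pure I (linear-larger a) , cong₂ _∷_ (cong ℤ.+_ (sym count₀)) (cong₂ _∷_ (cong ℤ.+_ (sym count₁)) refl)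
  where
  I : Ideal 1 (suc a) 0
  I = linearIdeal (suc a)
  open Ideal I

pure-1ab : ∀ a b → 1 ≤ b → a ≤ 2 * b → b ≤ triangular a → IsPureOSequence (ℤ.+ 1 ∷ ℤ.+ a ∷ ℤ.+ b ∷ [])
pure-1ab zero    b 1≤b _ b≤0 with () ← ≤-trans 1≤b b≤0
pure-1ab (suc a) b _ a≤2b b≤T = suc a , L , 2 , ideal-pure I (covered-larger I covered) ,
  cong₂ _∷_ (cong ℤ.+_ (sym count₀)) (cong₂ _∷_ (cong ℤ.+_ (sym count₁)) (cong₂ _∷_ (cong ℤ.+_ (sym count₂)) refl))
  where
  I : Ideal 2 (suc a) b
  I = proj₁ (realise (suc a) b a≤2b b≤T)

  covered : Covered (Ideal.L I)
  covered = proj₂ (realise (suc a) b a≤2b b≤T)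
  open Ideal I

admissible-pure : ∀ a b → Admissible a b → IsPureOSequence (dropTrailingZeros (ℤ.+ 1 ∷ ℤ.+ a ∷ ℤ.+ b ∷ []))
admissible-pure zero    zero    _                    = pure-1
admissible-pure (suc a) zero    _                    = pure-1a a
admissible-pure a       (suc b) (inj₂ (a≤2b , b≤T)) = pure-1ab a (suc b) (s≤s z≤n) a≤2b b≤T

theorem4p11 : (n : ℕ) (Δ : Family n) →
    IsSimplicialComplex Δ → IsMatroid Δ → HasDimension Δ 1 →
    IsPureOSequence (hVector Δ 1)
theorem4p11 n Δ sc mat dim with graph-counts Δ sc mat dim
... | c₀≡1 , a , b , c₁≡a+2 , c₂≡a+b+1 , admissible =
  subst IsPureOSequence (sym (cong dropTrailingZeros (hPoly-graph Δ a b c₀≡1 c₁≡a+2 c₂≡a+b+1)))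
        (admissible-pure a b admissible)
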